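{- For all positive integers $p$ and $q$, $m(p,q,2)=ex(p,q,K_{2,2})=p+q-1$.
   Context: All graphs are simple. An ordered bipartite graph $(G;A,B)$ is a bipartite graph $G$ whose vertex set is partitioned into independent sets $A$ and $B$, each equipped with a linear order. Two vertices $u<v$ of the same part are consecutive if no vertex $w$ of that part satisfies $u<w<v$. Identifying two consecutive vertices $u,v$ replaces them by a single vertex $w$ (in their place in the order) whose neighbourhood is the union of the neighbourhoods of $u$ and $v$. Two ordered bipartite graphs are isomorphic if there is a graph isomorphism between them that maps parts to parts (possibly exchanging the two parts) and preserves both linear orders. An ordered bipartite graph $H$ is an interval minor of $G$ if a graph isomorphic to $H$ can be obtained from $G$ by repeatedly deleting edges and identifying consecutive vertices; otherwise $G$ is $H$-interval minor free. $ex(p,q,H)$ denotes the maximum number of edges of an ordered bipartite graph with parts of sizes $p$ and $q$ that is $H$-interval minor free, and $m(p,q,\ell)=ex(p,q,K_{2,\ell})$. -}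

module Defs where

open import Data.Nat using (ℕ; zero; suc; _+_; _≤_; _<ᵇ_; _≤ᵇ_)
open import Data.Bool using (Bool; true; false; _∨_; if_then_else_)
open import Data.Fin using (Fin; zero; suc; toℕ; inject₁; _≟_)
open import Data.Product using (Σ; _×_)
open import Relation.Nullary using (¬_; yes; no)
open import Relation.Binary.PropositionalEquality using (_≡_)
open import Relation.Binary.Construct.Closure.ReflexiveTransitive using (Star)

-- An ordered bipartite graph with parts A = Fin p and B = Fin q,
-- each ordered by the natural order of Fin; the adjacency is a Bool matrix.
record OBG : Set where
  constructor mk
  field
    p : ℕ
    q : ℕ
    adj : Fin p → Fin q → Bool

open OBG public

sumFin : (n : ℕ) → (Fin n → ℕ) → ℕ
sumFin zero    f = 0
sumFin (suc n) f = f zero + sumFin n (λ i → f (suc i))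

b2n : Bool → ℕ
b2n true  = 1
b2n false = 0

edges : OBG → ℕ
edges (mk p q a) = sumFin p (λ i → sumFin q (λ j → b2n (a i j)))

delete : ∀ {p q} → (Fin p → Fin q → Bool) → Fin p → Fin q → (Fin p → Fin q → Bool)
delete a i j i' j' with i ≟ i' | j ≟ j'
... | yes _ | yes _ = false
... | _     | _     = a i' j'

-- Identifying the consecutive vertices i and i+1 of a part of size suc n
-- (i : Fin n).  The new vertex k : Fin n has preimages lo i k and hi i k
-- (equal unless k = i, in which case they are i and i+1).
lo : ∀ {n} → Fin n → Fin n → Fin (suc n)
lo i k = if toℕ k ≤ᵇ toℕ i then inject₁ k else suc k

hi : ∀ {n} → Fin n → Fin n → Fin (suc n)
hi i k = if toℕ k <ᵇ toℕ i then inject₁ k else suc k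

mergeA : ∀ {p q} → (Fin (suc p) → Fin q → Bool) → Fin p → (Fin p → Fin q → Bool)
mergeA a i k j = a (lo i k) j ∨ a (hi i k) j

mergeB : ∀ {p q} → (Fin p → Fin (suc q) → Bool) → Fin q → (Fin p → Fin q → Bool)
mergeB a i j k = a j (lo i k) ∨ a j (hi i k)

data Step : OBG → OBG → Set where
  del : ∀ {p q} (a : Fin p → Fin q → Bool) (i : Fin p) (j : Fin q) →
        Step (mk p q a) (mk p q (delete a i j))
  idA : ∀ {p q} (a : Fin (suc p) → Fin q → Bool) (i : Fin p) →
        Step (mk (suc p) q a) (mk p q (mergeA a i))
  idB : ∀ {p q} (a : Fin p → Fin (suc q) → Bool) (i : Fin q) →
        Step (mk p (suc q) a) (mk p q (mergeB a i))

-- Isomorphism of ordered bipartite graphs: the only order-preserving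
-- bijection Fin n → Fin n is the identity, so an isomorphism either keeps
-- the parts (same matrix) or exchanges them (transposed matrix).
data _≅_ : OBG → OBG → Set where
  same : ∀ {p q} (a b : Fin p → Fin q → Bool) →
         (∀ i j → a i j ≡ b i j) → mk p q a ≅ mk p q b
  swap : ∀ {p q} (a : Fin p → Fin q → Bool) (b : Fin q → Fin p → Bool) →
         (∀ i j → a i j ≡ b j i) → mk p q a ≅ mk q p b

IntervalMinor : OBG → OBG → Set
IntervalMinor H G = Σ OBG (λ G' → Star Step G G' × (G' ≅ H))

Free : OBG → OBG → Set
Free H G = ¬ IntervalMinor H G

ExIs : ℕ → ℕ → OBG → ℕ → Set
ExIs p q H N =
  Σ (Fin p → Fin q → Bool) (λ a → Free H (mk p q a) × edges (mk p q a) ≡ N)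
  × (∀ (a : Fin p → Fin q → Bool) → Free H (mk p q a) → edges (mk p q a) ≤ N)

K : ℕ → ℕ → OBG
K s t = mk s t (λ _ _ → true)

MIs : ℕ → ℕ → ℕ → ℕ → Set
MIs p q ℓ N = ExIs p q (K 2 ℓ) N

-- Upper bound, by induction on p: in a K₂,₂-free graph the first two rows share at most
-- one column, since two shared columns span an all-ones 2×2 rectangle, which contracts to
-- K₂,₂. So identifying the first two rows loses at most one edge and stays K₂,₂-free.
-- Lower bound: the cross (full first row and first column) has p + q − 1 edges, and
-- "every edge meets the first vertex of A or of B" survives deletions and identifications
-- but fails for K₂,₂.
module Submission where

open import Defs
open import Data.Nat using (ℕ; zero; suc; _+_; _∸_; _≤_; _<_; z≤n; s≤s; _≤ᵇ_; _<ᵇ_)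
open import Data.Nat.Properties
  using (+-assoc; +-comm; +-identityʳ; +-mono-≤; +-commutativeSemigroup; module ≤-Reasoning)
open import Algebra.Properties.CommutativeSemigroup +-commutativeSemigroup
  using (interchange; xy∙z≈xz∙y)
open import Data.Bool using (Bool; true; false; _∨_; _∧_; if_then_else_)
open import Data.Bool.Properties using (∨-idem; ∧-conicalˡ; ∧-conicalʳ)
open import Data.Fin using (Fin; zero; suc; toℕ; inject₁; _≟_)
open import Data.Fin.Properties using (toℕ-inject₁)
open import Data.Product using (Σ; ∃; ∃₂; _×_; _,_)
open import Data.Sum using (_⊎_; inj₁; inj₂; map₁; map₂)
open import Data.Empty using (⊥-elim)
open import Relation.Nullary using (¬_; yes; no)
open import Relation.Binary.PropositionalEquality
open import Relation.Binary.Construct.Closure.ReflexiveTransitive using (Star; ε; _◅_; _◅◅_)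

∨-trueˡ : ∀ {x} y → x ≡ true → x ∨ y ≡ true
∨-trueˡ y refl = refl

∨-trueʳ : ∀ x {y} → y ≡ true → x ∨ y ≡ true
∨-trueʳ true  _ = refl
∨-trueʳ false e = e

∨-true⁻ : ∀ x y → x ∨ y ≡ true → x ≡ true ⊎ y ≡ true
∨-true⁻ true  y _ = inj₁ refl
∨-true⁻ false y e = inj₂ e

b2n≤1 : ∀ b → b2n b ≤ 1
b2n≤1 true  = s≤s z≤n
b2n≤1 false = z≤n

b2n-∨-∧ : ∀ x y → b2n x + b2n y ≡ b2n (x ∨ y) + b2n (x ∧ y)
b2n-∨-∧ true  true  = refl
b2n-∨-∧ true  false = refl
b2n-∨-∧ false true  = refl
b2n-∨-∧ false false = refl

sumFin-cong : ∀ n {f g : Fin n → ℕ} → (∀ i → f i ≡ g i) → sumFin n f ≡ sumFin n g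
sumFin-cong zero    f≡g = refl
sumFin-cong (suc n) f≡g = cong₂ _+_ (f≡g zero) (sumFin-cong n (λ i → f≡g (suc i)))

sumFin-mono : ∀ n {f g : Fin n → ℕ} → (∀ i → f i ≤ g i) → sumFin n f ≤ sumFin n g
sumFin-mono zero    f≤g = z≤n
sumFin-mono (suc n) f≤g = +-mono-≤ (f≤g zero) (sumFin-mono n (λ i → f≤g (suc i)))

sumFin-+ : ∀ n (f g : Fin n → ℕ) →
  sumFin n (λ i → f i + g i) ≡ sumFin n f + sumFin n g
sumFin-+ zero    f g = refl
sumFin-+ (suc n) f g = trans
  (cong (f zero + g zero +_) (sumFin-+ n (λ i → f (suc i)) (λ i → g (suc i))))
  (interchange (f zero) (g zero) _ _)

sumFin-ones : ∀ n → sumFin n (λ _ → 1) ≡ n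
sumFin-ones zero    = refl
sumFin-ones (suc n) = cong suc (sumFin-ones n)

sumFin-zeros : ∀ n → sumFin n (λ _ → 0) ≡ 0
sumFin-zeros zero    = refl
sumFin-zeros (suc n) = sumFin-zeros n

count : ∀ {n} → (Fin n → Bool) → ℕ
count {n} f = sumFin n (λ j → b2n (f j))

count≤length : ∀ {n} (f : Fin n → Bool) → count f ≤ n
count≤length {n} f = subst (count f ≤_) (sumFin-ones n) (sumFin-mono n (λ j → b2n≤1 (f j)))

count-∨-∧ : ∀ {n} (f g : Fin n → Bool) →
  count f + count g ≡ count (λ j → f j ∨ g j) + count (λ j → f j ∧ g j)
count-∨-∧ {n} f g = begin
  count f + count g
    ≡⟨ sumFin-+ n _ _ ⟨
  sumFin n (λ j → b2n (f j) + b2n (g j))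
    ≡⟨ sumFin-cong n (λ j → b2n-∨-∧ (f j) (g j)) ⟩
  sumFin n (λ j → b2n (f j ∨ g j) + b2n (f j ∧ g j))
    ≡⟨ sumFin-+ n _ _ ⟩
  count (λ j → f j ∨ g j) + count (λ j → f j ∧ g j) ∎
  where open ≡-Reasoning

TwoTrues : ∀ {n} → (Fin n → Bool) → Set
TwoTrues f = ∃₂ λ j₁ j₂ → toℕ j₁ < toℕ j₂ × f j₁ ≡ true × f j₂ ≡ true

count≡0⊎true : ∀ {n} (f : Fin n → Bool) → count f ≡ 0 ⊎ ∃ λ j → f j ≡ true
count≡0⊎true {zero}  f = inj₁ refl
count≡0⊎true {suc n} f with f zero in f₀
... | true  = inj₂ (zero , f₀)
... | false = map₂ (λ { (j , fj) → suc j , fj }) (count≡0⊎true (λ j → f (suc j)))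

count≤1⊎TwoTrues : ∀ {n} (f : Fin n → Bool) → count f ≤ 1 ⊎ TwoTrues f
count≤1⊎TwoTrues {zero}  f = inj₁ z≤n
count≤1⊎TwoTrues {suc n} f with f zero in f₀
... | true with count≡0⊎true (λ j → f (suc j))
...   | inj₁ none rewrite none = inj₁ (s≤s z≤n)
...   | inj₂ (j , fj) = inj₂ (zero , suc j , s≤s z≤n , f₀ , fj)
count≤1⊎TwoTrues {suc n} f | false =
  map₂ (λ { (j₁ , j₂ , j₁<j₂ , f₁ , f₂) → suc j₁ , suc j₂ , s≤s j₁<j₂ , f₁ , f₂ })
       (count≤1⊎TwoTrues (λ j → f (suc j)))

Covers : ∀ {n} → Fin n → Fin n → Fin (suc n) → Set
Covers m k i = lo m k ≡ i ⊎ hi m k ≡ i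

mergeA-covers : ∀ {p q} (a : Fin (suc p) → Fin q → Bool) m k {i} j →
  Covers m k i → a i j ≡ true → mergeA a m k j ≡ true
mergeA-covers a m k j (inj₁ refl) e = ∨-trueˡ _ e
mergeA-covers a m k j (inj₂ refl) e = ∨-trueʳ _ e

mergeB-covers : ∀ {p q} (a : Fin p → Fin (suc q) → Bool) m k {i} j →
  Covers m k i → a j i ≡ true → mergeB a m j k ≡ true
mergeB-covers a m k j (inj₁ refl) e = ∨-trueˡ _ e
mergeB-covers a m k j (inj₂ refl) e = ∨-trueʳ _ e

identify-keeping-apart : ∀ {n} (i₁ i₂ : Fin (3 + n)) → toℕ i₁ < toℕ i₂ →
  Σ (Fin (2 + n)) λ m → ∃₂ λ k₁ k₂ →
    toℕ k₁ < toℕ k₂ × Covers m k₁ i₁ × Covers m k₂ i₂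
identify-keeping-apart zero          (suc zero)    _ =
  suc zero , zero , suc zero , s≤s z≤n , inj₁ refl , inj₁ refl
identify-keeping-apart zero          (suc (suc k)) _ =
  zero , zero , suc k , s≤s z≤n , inj₁ refl , inj₂ refl
identify-keeping-apart (suc zero)    (suc (suc k)) _ =
  zero , zero , suc k , s≤s z≤n , inj₂ refl , inj₂ refl
identify-keeping-apart (suc (suc k₁)) (suc (suc k₂)) (s≤s k₁<k₂) =
  zero , suc k₁ , suc k₂ , k₁<k₂ , inj₂ refl , inj₂ refl
identify-keeping-apart (suc zero)    (suc zero)    (s≤s ())

rows-to-two : ∀ p {q} (a : Fin p → Fin q → Bool) (i₁ i₂ : Fin p) → toℕ i₁ < toℕ i₂ →
  Σ (Fin 2 → Fin q → Bool) λ b → Star Step (mk p q a) (mk 2 q b) ×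
    (∀ j → a i₁ j ≡ true → b zero j ≡ true) × (∀ j → a i₂ j ≡ true → b (suc zero) j ≡ true)
rows-to-two (suc (suc zero)) a zero (suc zero) _ = a , ε , (λ _ e → e) , (λ _ e → e)
rows-to-two (suc (suc zero)) a (suc zero) (suc zero) (s≤s ())
rows-to-two (suc (suc (suc n))) a i₁ i₂ i₁<i₂ =
  let m , k₁ , k₂ , k₁<k₂ , c₁ , c₂ = identify-keeping-apart i₁ i₂ i₁<i₂
      b , steps , sub₁ , sub₂ = rows-to-two (suc (suc n)) (mergeA a m) k₁ k₂ k₁<k₂
  in b , idA a m ◅ steps ,
     (λ j e → sub₁ j (mergeA-covers a m k₁ j c₁ e)) ,
     (λ j e → sub₂ j (mergeA-covers a m k₂ j c₂ e))

cols-to-two : ∀ {p} q (a : Fin p → Fin q → Bool) (j₁ j₂ : Fin q) → toℕ j₁ < toℕ j₂ →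
  Σ (Fin p → Fin 2 → Bool) λ b → Star Step (mk p q a) (mk p 2 b) ×
    (∀ i → a i j₁ ≡ true → b i zero ≡ true) × (∀ i → a i j₂ ≡ true → b i (suc zero) ≡ true)
cols-to-two (suc (suc zero)) a zero (suc zero) _ = a , ε , (λ _ e → e) , (λ _ e → e)
cols-to-two (suc (suc zero)) a (suc zero) (suc zero) (s≤s ())
cols-to-two (suc (suc (suc n))) a j₁ j₂ j₁<j₂ =
  let m , k₁ , k₂ , k₁<k₂ , c₁ , c₂ = identify-keeping-apart j₁ j₂ j₁<j₂
      b , steps , sub₁ , sub₂ = cols-to-two (suc (suc n)) (mergeB a m) k₁ k₂ k₁<k₂
  in b , idB a m ◅ steps ,
     (λ i e → sub₁ i (mergeB-covers a m k₁ i c₁ e)) ,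
     (λ i e → sub₂ i (mergeB-covers a m k₂ i c₂ e))

rectangle⇒K22-minor : ∀ {p q} (a : Fin p → Fin q → Bool) {i₁ i₂ j₁ j₂} →
  toℕ i₁ < toℕ i₂ → toℕ j₁ < toℕ j₂ →
  a i₁ j₁ ≡ true → a i₁ j₂ ≡ true → a i₂ j₁ ≡ true → a i₂ j₂ ≡ true →
  IntervalMinor (K 2 2) (mk p q a)
rectangle⇒K22-minor {p} {q} a {i₁} {i₂} {j₁} {j₂} i₁<i₂ j₁<j₂ e₁₁ e₁₂ e₂₁ e₂₂ =
  let b , rows , r₁ , r₂ = rows-to-two p a i₁ i₂ i₁<i₂
      c , cols , c₁ , c₂ = cols-to-two q b j₁ j₂ j₁<j₂
  in mk 2 2 c , rows ◅◅ cols , same c _ λ where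
       zero       zero       → c₁ zero       (r₁ j₁ e₁₁)
       zero       (suc zero) → c₂ zero       (r₁ j₂ e₁₂)
       (suc zero) zero       → c₁ (suc zero) (r₂ j₁ e₂₁)
       (suc zero) (suc zero) → c₂ (suc zero) (r₂ j₂ e₂₂)

Step-preserves-Free : ∀ {H G G′} → Step G G′ → Free H G → Free H G′
Step-preserves-Free step free (G″ , steps , G″≅H) = free (G″ , step ◅ steps , G″≅H)

edges-mergeA-zero : ∀ {n q} (a : Fin (2 + n) → Fin q → Bool) →
  edges (mk (2 + n) q a) ≡
  edges (mk (suc n) q (mergeA a zero)) + count (λ j → a zero j ∧ a (suc zero) j)
edges-mergeA-zero {n} {q} a = begin
  count row₀ + (count row₁ + rest)      ≡⟨ +-assoc (count row₀) _ _ ⟨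
  (count row₀ + count row₁) + rest      ≡⟨ cong (_+ rest) (count-∨-∧ row₀ row₁) ⟩
  (count row₀₁ + count common) + rest   ≡⟨ xy∙z≈xz∙y (count row₀₁) _ _ ⟩
  (count row₀₁ + rest) + count common   ≡⟨ cong (λ r → count row₀₁ + r + count common) rest≡ ⟩
  edges (mk (suc n) q (mergeA a zero)) + count common ∎
  where
  open ≡-Reasoning
  row₀ row₁ row₀₁ common : Fin q → Bool
  row₀ = a zero
  row₁ = a (suc zero)
  row₀₁ j = row₀ j ∨ row₁ j
  common j = row₀ j ∧ row₁ j
  rest : ℕ
  rest = sumFin n (λ i → count (a (suc (suc i))))
  rest≡ : rest ≡ sumFin n (λ i → count (λ j → a (suc (suc i)) j ∨ a (suc (suc i)) j))
  rest≡ = sumFin-cong n (λ i → sumFin-cong q (λ j → cong b2n (sym (∨-idem (a (suc (suc i)) j)))))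

K22-free⇒edges≤ : ∀ n q (a : Fin (suc n) → Fin q → Bool) →
  Free (K 2 2) (mk (suc n) q a) → edges (mk (suc n) q a) ≤ n + q
K22-free⇒edges≤ zero q a free =
  subst (_≤ q) (sym (+-identityʳ (count (a zero)))) (count≤length (a zero))
K22-free⇒edges≤ (suc n) q a free with count≤1⊎TwoTrues (λ j → a zero j ∧ a (suc zero) j)
... | inj₂ (j₁ , j₂ , j₁<j₂ , e₁ , e₂) =
  ⊥-elim (free (rectangle⇒K22-minor a (s≤s z≤n) j₁<j₂
    (∧-conicalˡ _ _ e₁) (∧-conicalˡ _ _ e₂) (∧-conicalʳ _ _ e₁) (∧-conicalʳ _ _ e₂)))
... | inj₁ common≤1 = begin
  edges (mk (2 + n) q a)
    ≡⟨ edges-mergeA-zero a ⟩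
  edges (mk (suc n) q (mergeA a zero)) + count (λ j → a zero j ∧ a (suc zero) j)
    ≤⟨ +-mono-≤ (K22-free⇒edges≤ n q (mergeA a zero) (Step-preserves-Free (idA a zero) free))
                common≤1 ⟩
  n + q + 1
    ≡⟨ +-comm (n + q) 1 ⟩
  suc n + q ∎
  where open ≤-Reasoning

cross : ∀ {p q} → Fin p → Fin q → Bool
cross zero    _       = true
cross (suc _) zero    = true
cross (suc _) (suc _) = false

cross-edges : ∀ n m → edges (mk (suc n) (suc m) cross) ≡ suc n + suc m ∸ 1
cross-edges n m = begin
  suc (sumFin m (λ _ → 1)) + sumFin n (λ _ → suc (sumFin m (λ _ → 0)))
    ≡⟨ cong₂ (λ x y → suc x + y)
             (sumFin-ones m) (sumFin-cong n (λ _ → cong suc (sumFin-zeros m))) ⟩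
  suc m + sumFin n (λ _ → 1)   ≡⟨ cong (suc m +_) (sumFin-ones n) ⟩
  suc m + n                    ≡⟨ +-comm (suc m) n ⟩
  n + suc m ∎
  where open ≡-Reasoning

EdgesAtFirst : OBG → Set
EdgesAtFirst G = ∀ i j → adj G i j ≡ true → toℕ i ≡ 0 ⊎ toℕ j ≡ 0

-- Both lo m k and hi m k unfold to this shape.
toℕ-shift≡0 : ∀ {n} b (k : Fin n) → toℕ (if b then inject₁ k else suc k) ≡ 0 → toℕ k ≡ 0
toℕ-shift≡0 true  k k≡0 = trans (sym (toℕ-inject₁ k)) k≡0
toℕ-shift≡0 false k ()

delete-true⁻ : ∀ {p q} (a : Fin p → Fin q → Bool) i j i′ j′ →
  delete a i j i′ j′ ≡ true → a i′ j′ ≡ true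
delete-true⁻ a i j i′ j′ e with i ≟ i′ | j ≟ j′
delete-true⁻ a i j i′ j′ () | yes _ | yes _
delete-true⁻ a i j i′ j′ e  | yes _ | no _ = e
delete-true⁻ a i j i′ j′ e  | no _  | _    = e

Step-preserves-EdgesAtFirst : ∀ {G G′} → Step G G′ → EdgesAtFirst G → EdgesAtFirst G′
Step-preserves-EdgesAtFirst (del a i j) atFirst i′ j′ e =
  atFirst i′ j′ (delete-true⁻ a i j i′ j′ e)
Step-preserves-EdgesAtFirst (idA a m) atFirst k j e with ∨-true⁻ (a (lo m k) j) (a (hi m k) j) e
... | inj₁ e-lo = map₁ (toℕ-shift≡0 (toℕ k ≤ᵇ toℕ m) k) (atFirst _ j e-lo)
... | inj₂ e-hi = map₁ (toℕ-shift≡0 (toℕ k <ᵇ toℕ m) k) (atFirst _ j e-hi)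
Step-preserves-EdgesAtFirst (idB a m) atFirst i k e with ∨-true⁻ (a i (lo m k)) (a i (hi m k)) e
... | inj₁ e-lo = map₂ (toℕ-shift≡0 (toℕ k ≤ᵇ toℕ m) k) (atFirst i _ e-lo)
... | inj₂ e-hi = map₂ (toℕ-shift≡0 (toℕ k <ᵇ toℕ m) k) (atFirst i _ e-hi)

Star-preserves-EdgesAtFirst : ∀ {G G′} → Star Step G G′ → EdgesAtFirst G → EdgesAtFirst G′
Star-preserves-EdgesAtFirst ε              atFirst = atFirst
Star-preserves-EdgesAtFirst (step ◅ steps) atFirst =
  Star-preserves-EdgesAtFirst steps (Step-preserves-EdgesAtFirst step atFirst)

EdgesAtFirst⇒K22-free : ∀ {G} → EdgesAtFirst G → Free (K 2 2) G
EdgesAtFirst⇒K22-free atFirst (G′ , steps , G′≅K22) =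
  no-edge-at-1-1 G′≅K22 (Star-preserves-EdgesAtFirst steps atFirst)
  where
  no-edge-at-1-1 : ∀ {G′} → G′ ≅ K 2 2 → ¬ EdgesAtFirst G′
  no-edge-at-1-1 (same a _ a≡) atFirst′ with atFirst′ (suc zero) (suc zero) (a≡ _ _)
  ... | inj₁ ()
  ... | inj₂ ()
  no-edge-at-1-1 (swap a _ a≡) atFirst′ with atFirst′ (suc zero) (suc zero) (a≡ _ _)
  ... | inj₁ ()
  ... | inj₂ ()

cross-EdgesAtFirst : ∀ {p q} → EdgesAtFirst (mk p q cross)
cross-EdgesAtFirst zero    _       _  = inj₁ refl
cross-EdgesAtFirst (suc _) zero    _  = inj₂ refl
cross-EdgesAtFirst (suc _) (suc _) ()

ex-K22 : ∀ p q → 1 ≤ p → 1 ≤ q → ExIs p q (K 2 2) (p + q ∸ 1)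
ex-K22 (suc n) (suc m) _ _ =
  (cross , EdgesAtFirst⇒K22-free cross-EdgesAtFirst , cross-edges n m) ,
  K22-free⇒edges≤ n (suc m)

lemma3p1 : (p q : ℕ) → 1 ≤ p → 1 ≤ q →
    MIs p q 2 (p + q ∸ 1) × ExIs p q (K 2 2) (p + q ∸ 1)
lemma3p1 p q 1≤p 1≤q = ex-K22 p q 1≤p 1≤q , ex-K22 p q 1≤p 1≤q
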